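{- Fix $k\in\mathbb{N}$. For any $\mathcal{L}$-sentence $A$, if $\mathcal{M}_k\models A\leftrightarrow\forall u\,\Box(A\to P(u))$, then for every $n\leq k$: $\mathcal{M}_k,n\models A$ if and only if $n$ is even.
   Context: Language $\mathcal{L}$: individual variables, $\top,\bot$, $\neg,\to$, $\forall$, $\Box$, and predicate symbols; $P$ is a fixed unary predicate symbol. Kripke models $\langle W,\prec,\{D_w\},\Vdash\rangle$ with increasing domains; truth at a world is standard ($\forall$ ranges over $D_w$, $\Box B$ true at $w$ iff $B$ true at all $\prec$-successors). A formula is valid in a model ($\mathcal{M}\models B$) if its universal closure is true at every world. For $k\in\mathbb{N}$, $\mathcal{M}_k=\langle W_k,\prec_k,\{D^k_n\}_{n\in W_k},\Vdash_k\rangle$ with $W_k=\{0,1,\ldots,k\}$, $m\prec_k n$ iff $n<m$, $D^k_n=\{n,n+1,\ldots,k+2\}$, and $n\Vdash_k P(m)$ iff $m\neq n+1$ (predicate symbols other than $P$ are interpreted in some fixed arbitrary way). -}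

module Defs where

open import Data.Nat using (ℕ; zero; suc; _≤_; _<_; _+_; _∸_)
open import Data.Bool using (Bool; true; false; not; _∨_; _∧_)
open import Relation.Nullary.Decidable using (⌊_⌋)
open import Data.Nat.Properties using (_≟_)
open import Data.List using (List; []; _∷_; map; upTo; applyUpTo)
open import Data.List.Membership.Propositional using (_∈_)
open import Data.List.Relation.Unary.All using (All)
open import Data.Unit using (⊤)
open import Data.Empty using (⊥)
open import Data.Product using (_×_)
open import Relation.Nullary using (¬_; yes; no)
open import Relation.Binary.PropositionalEquality using (_≡_; refl)

Var : Set
Var = ℕ

data Formula : Set where
  ⊤'  : Formula
  ⊥'  : Formula
  P'  : Var → Formula
  R'  : ℕ → List Var → Formula
  ¬'_ : Formula → Formula
  _⇒'_ : Formula → Formula → Formula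
  ∀'  : Var → Formula → Formula
  □'  : Formula → Formula

infixr 5 _⇒'_

-- Biconditional as the usual abbreviation in terms of ¬ and →:
-- (A → B) ∧ (B → A)  :=  ¬((A → B) → ¬(B → A)).
_⇔'_ : Formula → Formula → Formula
A ⇔' B = ¬' ((A ⇒' B) ⇒' (¬' (B ⇒' A)))

ClosedUnder : List Var → Formula → Set
ClosedUnder bs ⊤' = ⊤
ClosedUnder bs ⊥' = ⊤
ClosedUnder bs (P' x) = x ∈ bs
ClosedUnder bs (R' i xs) = All (_∈ bs) xs
ClosedUnder bs (¬' A) = ClosedUnder bs A
ClosedUnder bs (A ⇒' B) = ClosedUnder bs A × ClosedUnder bs B
ClosedUnder bs (∀' x A) = ClosedUnder (x ∷ bs) A
ClosedUnder bs (□' A) = ClosedUnder bs A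

Sentence : Formula → Set
Sentence = ClosedUnder []

-- Interpretation of the predicate symbols other than P:
-- I i w ds = true  means  w ⊩ R_i(ds).  (Arbitrary, fixed.)
-- Truth values are classical (Bool), as in the paper's classical Kripke semantics.
Interp : Set
Interp = ℕ → ℕ → List ℕ → Bool

Assignment : Set
Assignment = Var → ℕ

update : Assignment → Var → ℕ → Assignment
update σ x d y with y ≟ x
... | yes _ = d
... | no  _ = σ y

-- [ a , b ] as a list of naturals a, a+1, …, b.
range : ℕ → ℕ → List ℕ
range a b = applyUpTo (a +_) (suc b ∸ a)

allB : {A : Set} → (A → Bool) → List A → Bool
allB p [] = true
allB p (x ∷ xs) = p x ∧ allB p xs

-- The model M_k: worlds 0..k, m ≺ n iff n < m, D_n = {n, …, k+2},
-- n ⊩ P(m) iff m ≠ n+1.  Forces k I w σ A = true : "M_k, w ⊩ A [σ]".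
Forces : ℕ → Interp → ℕ → Assignment → Formula → Bool
Forces k I w σ ⊤' = true
Forces k I w σ ⊥' = false
Forces k I w σ (P' x) = not ⌊ σ x ≟ suc w ⌋
Forces k I w σ (R' i xs) = I i w (map σ xs)
Forces k I w σ (¬' A) = not (Forces k I w σ A)
Forces k I w σ (A ⇒' B) = not (Forces k I w σ A) ∨ Forces k I w σ B
Forces k I w σ (∀' x A) =
  allB (λ d → Forces k I w (update σ x d) A) (range w (k + 2))
Forces k I w σ (□' A) = allB (λ m → Forces k I m σ A) (upTo w)

Admissible : ℕ → ℕ → Assignment → Set
Admissible k w σ = (x : Var) → w ≤ σ x × σ x ≤ k + 2

-- M_k, w ⊨ A : the universal closure of A is true at w.
TrueAt : ℕ → Interp → ℕ → Formula → Set
TrueAt k I w A = (σ : Assignment) → Admissible k w σ → Forces k I w σ A ≡ true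

Valid : ℕ → Interp → Formula → Set
Valid k I A = (w : ℕ) → w ≤ k → TrueAt k I w A

private
  r : range 2 5 ≡ 2 ∷ 3 ∷ 4 ∷ 5 ∷ []
  r = refl

module Submission where

-- Write a(w) for the
-- truth value of A at world w (under any assignment into D_w).  The
-- worlds seen from w are exactly 0, …, w-1, so the fixed-point equation
-- determines a(w) from the values below w:
--   * a(0) = true, since the box at the ⪯-maximal world 0 is vacuous;
--   * a(w+1) = ¬ a(w): the quantifier ranges over d ∈ [w+1, k+2], and
--     P(d) can only fail at a world m ≤ w when d = m+1, which for
--     d ≥ w+1 forces m = w and d = w+1.  Hence the box fails exactly
--     when A holds at w under u := w+1.
-- By induction a(w) = even w, which is the theorem.
-- The argument never uses that A is closed: it is carried out for every
-- admissible assignment simultaneously.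

open import Defs
open import Data.Nat using (ℕ; _≤_)
open import Data.Nat.Divisibility using (_∣_)
open import Function.Bundles using (_⇔_)

open import Data.Nat using (zero; suc; _+_; _<_; z≤n; s≤s; s≤s⁻¹)
open import Data.Nat.Properties
  using (_≟_; ≤-refl; ≤-trans; <⇒≤; <-≤-trans; <⇒≢; m≤m+n; n≤1+n;
         +-comm; +-suc;
         m+[n∸m]≡n; ∸-monoˡ-<; m∸n≢0⇒n<m; m≤o∸n⇒m+n≤o; m<1+n⇒m<n∨m≡n)
open import Data.Nat.Divisibility using (∣⇒≤; ∣m∣n⇒∣m+n; ∣m+n∣m⇒∣n; ∣-refl; divides)
open import Data.Bool using (Bool; true; false; not)
open import Data.Bool.Properties using (not-involutive)
open import Data.List using (List; []; _∷_; upTo)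
open import Data.List.Membership.Propositional using (_∈_)
open import Data.List.Membership.Propositional.Properties
  using (∈-applyUpTo⁺; ∈-applyUpTo⁻; ∈-upTo⁺; ∈-upTo⁻)
open import Data.List.Relation.Unary.Any using (here; there)
open import Data.Product using (_×_; _,_; proj₁; proj₂)
open import Data.Sum using (_⊎_; inj₁; inj₂)
open import Function.Bundles using (mk⇔; Equivalence)
open import Relation.Nullary using (yes; no; contradiction)
open import Relation.Binary.PropositionalEquality
  using (_≡_; _≢_; refl; sym; trans; subst)

-- Boolean parity, the shape in which the recurrence a(w+1) = ¬ a(w) unfolds.
even : ℕ → Bool
even zero    = true
even (suc n) = not (even n)

even⇔2∣ : ∀ n → (even n ≡ true) ⇔ (2 ∣ n)
even⇔2∣ zero          = mk⇔ (λ _ → divides 0 refl) (λ _ → refl)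
even⇔2∣ (suc zero)    = mk⇔ (λ ()) (λ 2∣1 → contradiction (∣⇒≤ 2∣1) λ { (s≤s ()) })
even⇔2∣ (suc (suc n)) = mk⇔
  (λ e → ∣m∣n⇒∣m+n ∣-refl (to (subst (_≡ true) (not-involutive (even n)) e)))
  (λ 2∣n+2 → trans (not-involutive (even n)) (from (∣m+n∣m⇒∣n 2∣n+2 ∣-refl)))
  where open Equivalence (even⇔2∣ n)

allB-true : ∀ {X : Set} (p : X → Bool) (xs : List X) →
  (∀ {x} → x ∈ xs → p x ≡ true) → allB p xs ≡ true
allB-true p []       _   = refl
allB-true p (x ∷ xs) all-p
  rewrite all-p (here refl) = allB-true p xs (λ x∈xs → all-p (there x∈xs))

allB-false : ∀ {X : Set} (p : X → Bool) {xs : List X} {x : X} →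
  x ∈ xs → p x ≡ false → allB p xs ≡ false
allB-false p {y ∷ _} (here refl) px rewrite px = refl
allB-false p {y ∷ _} (there x∈xs) px with p y
... | true  = allB-false p x∈xs px
... | false = refl

∈-range⁺ : ∀ {a b d} → a ≤ d → d ≤ b → d ∈ range a b
∈-range⁺ {a} {b} {d} a≤d d≤b =
  subst (_∈ range a b) (m+[n∸m]≡n a≤d) (∈-applyUpTo⁺ (a +_) (∸-monoˡ-< (s≤s d≤b) a≤d))

∈-range⁻ : ∀ {a b d} → d ∈ range a b → a ≤ d × d ≤ b
∈-range⁻ {a} {b} d∈range with ∈-applyUpTo⁻ (a +_) d∈range
... | i , i<len , refl = m≤m+n a i , s≤s⁻¹ (subst (_≤ suc b) reorder 1+i+a≤1+b)
  where
  a≤1+b : a ≤ suc b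
  a≤1+b = <⇒≤ (m∸n≢0⇒n<m λ len≡0 → contradiction (subst (i <_) len≡0 i<len) λ ())
  1+i+a≤1+b : suc i + a ≤ suc b
  1+i+a≤1+b = m≤o∸n⇒m+n≤o (suc i) a≤1+b i<len
  reorder : suc i + a ≡ suc (a + i)
  reorder = trans (+-comm (suc i) a) (+-suc a i)

forces-⇔ : ∀ {k I w σ} B C →
  Forces k I w σ (B ⇔' C) ≡ true → Forces k I w σ B ≡ Forces k I w σ C
forces-⇔ {k} {I} {w} {σ} B C _ with Forces k I w σ B | Forces k I w σ C
forces-⇔ B C _  | true  | true  = refl
forces-⇔ B C _  | false | false = refl
forces-⇔ B C () | true  | false
forces-⇔ B C () | false | true

⇒-false : ∀ {k I w σ} B C →
  Forces k I w σ B ≡ true → Forces k I w σ C ≡ false →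
  Forces k I w σ (B ⇒' C) ≡ false
⇒-false B C b c rewrite b | c = refl

⇒-true-antecedent : ∀ {k I w σ} B C →
  Forces k I w σ B ≡ false → Forces k I w σ (B ⇒' C) ≡ true
⇒-true-antecedent B C b rewrite b = refl

⇒-true-consequent : ∀ {k I w σ} B C →
  Forces k I w σ C ≡ true → Forces k I w σ (B ⇒' C) ≡ true
⇒-true-consequent {k} {I} {w} {σ} B C c rewrite c with Forces k I w σ B
... | true  = refl
... | false = refl

P-false : ∀ {k I w} σ x → σ x ≡ suc w → Forces k I w σ (P' x) ≡ false
P-false {w = w} σ x eq with σ x ≟ suc w
... | yes _ = refl
... | no  ne = contradiction eq ne

P-true : ∀ {k I w} σ x → σ x ≢ suc w → Forces k I w σ (P' x) ≡ true
P-true {w = w} σ x ne with σ x ≟ suc w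
... | yes eq = contradiction eq ne
... | no  _  = refl

update-same : ∀ σ x d → update σ x d x ≡ d
update-same σ x d with x ≟ x
... | yes _ = refl
... | no ne = contradiction refl ne

update-admissible : ∀ {k w σ} x d → w ≤ d → d ≤ k + 2 →
  Admissible k w σ → Admissible k w (update σ x d)
update-admissible x d w≤d d≤k+2 adm y with y ≟ x
... | yes _ = w≤d , d≤k+2
... | no  _ = adm y

admissible-mono : ∀ {k v w σ} → v ≤ w → Admissible k w σ → Admissible k v σ
admissible-mono v≤w adm x = ≤-trans v≤w (proj₁ (adm x)) , proj₂ (adm x)

module FixedPoint (k : ℕ) (I : Interp) (A : Formula) (u : Var)
                  (fix : Valid k I (A ⇔' ∀' u (□' (A ⇒' P' u)))) where

  RHS : Formula
  RHS = ∀' u (□' (A ⇒' P' u))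

  instanceAt : Assignment → ℕ → ℕ → Bool
  instanceAt σ d m = Forces k I m (update σ u d) (A ⇒' P' u)

  boxAt : ℕ → Assignment → ℕ → Bool
  boxAt w σ d = allB (instanceAt σ d) (upTo w)

  instance-fails : ∀ {σ d m} → Forces k I m (update σ u d) A ≡ true → d ≡ suc m →
    instanceAt σ d m ≡ false
  instance-fails {σ} {d} {m} A-true d≡1+m = ⇒-false {k} {I} {m} {update σ u d} A (P' u)
    A-true (P-false {k} {I} (update σ u d) u (trans (update-same σ u d) d≡1+m))

  instance-by-antecedent : ∀ {σ d m} → Forces k I m (update σ u d) A ≡ false →
    instanceAt σ d m ≡ true
  instance-by-antecedent = ⇒-true-antecedent A (P' u)

  instance-by-consequent : ∀ {σ d m} → d ≢ suc m → instanceAt σ d m ≡ true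
  instance-by-consequent {σ} {d} {m} d≢1+m = ⇒-true-consequent {k} {I} {m} {update σ u d}
    A (P' u) (P-true {k} {I} (update σ u d) u (λ eq → d≢1+m (trans (sym (update-same σ u d)) eq)))

  -- At the ≺-maximal world 0 nothing is seen, so the box is vacuously true.
  A-at-0 : ∀ σ → Admissible k 0 σ → Forces k I 0 σ A ≡ true
  A-at-0 σ adm = trans (forces-⇔ A RHS (fix 0 z≤n σ adm))
                       (allB-true (boxAt 0 σ) (range 0 (k + 2)) (λ _ → refl))

  module Step {w : ℕ} (w<k : suc w ≤ k) where

    adm-at-w : ∀ {σ d} → Admissible k (suc w) σ → d ∈ range (suc w) (k + 2) →
      Admissible k w (update σ u d)
    adm-at-w adm d∈ = update-admissible u _ (<⇒≤ (proj₁ (∈-range⁻ d∈)))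
      (proj₂ (∈-range⁻ d∈)) (admissible-mono (n≤1+n w) adm)

    -- If A holds at w, the witness d = w + 1 refutes the box at world w + 1.
    box-fails : (∀ σ → Admissible k w σ → Forces k I w σ A ≡ true) →
      ∀ σ → Admissible k (suc w) σ → Forces k I (suc w) σ A ≡ false
    box-fails A-at-w σ adm = trans (forces-⇔ A RHS (fix (suc w) w<k σ adm))
      (allB-false (boxAt (suc w) σ) w+1∈ (allB-false (instanceAt σ (suc w)) (∈-upTo⁺ ≤-refl)
        (instance-fails (A-at-w _ (adm-at-w adm w+1∈)) refl)))
      where
      w+1∈ : suc w ∈ range (suc w) (k + 2)
      w+1∈ = ∈-range⁺ ≤-refl (≤-trans w<k (m≤m+n k 2))

    -- If A fails at w, every instance seen from w + 1 holds: at m = w the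
    -- antecedent is false, and at m < w the value d ≥ w + 1 differs from m + 1.
    box-holds : (∀ σ → Admissible k w σ → Forces k I w σ A ≡ false) →
      ∀ σ → Admissible k (suc w) σ → Forces k I (suc w) σ A ≡ true
    box-holds A-at-w σ adm = trans (forces-⇔ A RHS (fix (suc w) w<k σ adm))
      (allB-true (boxAt (suc w) σ) (range (suc w) (k + 2)) λ d∈ →
        allB-true (instanceAt σ _) (upTo (suc w)) λ m∈ →
        instance-holds d∈ (m<1+n⇒m<n∨m≡n (∈-upTo⁻ m∈)))
      where
      instance-holds : ∀ {d m} → d ∈ range (suc w) (k + 2) → m < w ⊎ m ≡ w →
        instanceAt σ d m ≡ true
      instance-holds d∈ (inj₂ refl) = instance-by-antecedent (A-at-w _ (adm-at-w adm d∈))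
      instance-holds d∈ (inj₁ m<w)  = instance-by-consequent
        (λ d≡1+m → <⇒≢ (<-≤-trans (s≤s m<w) (proj₁ (∈-range⁻ d∈))) (sym d≡1+m))

  A-parity : ∀ w → w ≤ k → ∀ σ → Admissible k w σ → Forces k I w σ A ≡ even w
  A-parity zero    _   = A-at-0
  A-parity (suc w) w<k with even w | A-parity w (≤-trans (n≤1+n w) w<k)
  ... | true  | A-at-w = Step.box-fails w<k A-at-w
  ... | false | A-at-w = Step.box-holds w<k A-at-w

lemma3p5 : (k : ℕ) (I : Interp) (A : Formula) (u : Var) →
    Sentence A →
    Valid k I (A ⇔' ∀' u (□' (A ⇒' P' u))) →
    (n : ℕ) → n ≤ k → (TrueAt k I n A ⇔ (2 ∣ n))
lemma3p5 k I A u _ fix n n≤k = mk⇔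
  (λ A-true → to (trans (sym (A-parity n n≤k σₙ adm-σₙ)) (A-true σₙ adm-σₙ)))
  (λ 2∣n σ adm → trans (A-parity n n≤k σ adm) (from 2∣n))
  where
  open FixedPoint k I A u fix
  open Equivalence (even⇔2∣ n)
  σₙ : Assignment
  σₙ _ = n
  adm-σₙ : Admissible k n σₙ
  adm-σₙ _ = ≤-refl , ≤-trans n≤k (m≤m+n k 2)
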